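{- Let $G$ be a connected graph of order $n\ge 2$ and let $H$ be a non-trivial graph. If there exists a local adjacency basis $S$ for $H$ such that $S\not\subseteq N_H(v)$ for every $v\in V(H)\setminus S$, then $$\operatorname{dim}_{A,l}(G\odot H)=n\cdot \operatorname{dim}_{A,l}(H).$$
   Context: All graphs are finite, simple, undirected; non-trivial means order at least 2. A set $S\subseteq V(H)$ is a local adjacency generator for $H$ if for every two adjacent vertices $x,y\in V(H)\setminus S$ there exists $s\in S$ with $|N_H(s)\cap\{x,y\}|=1$ ($N_H$ the open neighbourhood); a local adjacency basis is a local adjacency generator of minimum cardinality, and this cardinality is $\operatorname{dim}_{A,l}(H)$. The corona product $G\odot H$ ($G$ of order $n$ with vertices $v_1,\dots,v_n$) consists of $G$ and $n$ disjoint copies $H_1,\dots,H_n$ of $H$, with $v_i$ joined to every vertex of $H_i$. -}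

module Defs where

open import Data.Nat using (ℕ; _+_; _*_; _≤_)
open import Data.Fin using (Fin; splitAt; remQuot)
open import Data.Fin.Subset using (Subset; _∈_; _∉_; ∣_∣)
open import Data.Sum using (_⊎_; inj₁; inj₂)
open import Data.Product using (Σ; _×_; _,_; ∃)
open import Data.Empty using (⊥)
open import Relation.Nullary using (¬_)
open import Relation.Binary.PropositionalEquality using (_≡_)

record Graph : Set₁ where
  field
    order   : ℕ
    Adj     : Fin order → Fin order → Set
    sym     : ∀ {x y} → Adj x y → Adj y x
    irrefl  : ∀ {x} → ¬ Adj x x
open Graph public

data Reach (G : Graph) : Fin (order G) → Fin (order G) → Set where
  here  : ∀ {u} → Reach G u u
  step  : ∀ {u v w} → Adj G u v → Reach G v w → Reach G u w

Connected : Graph → Set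
Connected G = ∀ u v → Reach G u v

NonTrivial : Graph → Set
NonTrivial G = 2 ≤ order G

Distinguishes : ∀ {V} → (Fin V → Fin V → Set) → Fin V → Fin V → Fin V → Set
Distinguishes Adj s x y = (Adj s x × ¬ Adj s y) ⊎ (¬ Adj s x × Adj s y)

IsLocalAdjGen : ∀ {V} → (Fin V → Fin V → Set) → Subset V → Set
IsLocalAdjGen {V} Adj S =
  ∀ (x y : Fin V) → Adj x y → x ∉ S → y ∉ S →
    Σ (Fin V) λ s → s ∈ S × Distinguishes Adj s x y

IsLocalAdjBasis : ∀ {V} → (Fin V → Fin V → Set) → Subset V → Set
IsLocalAdjBasis {V} Adj S =
  IsLocalAdjGen Adj S × (∀ (T : Subset V) → IsLocalAdjGen Adj T → ∣ S ∣ ≤ ∣ T ∣)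

LocalAdjDim : ∀ {V} → (Fin V → Fin V → Set) → ℕ → Set
LocalAdjDim {V} Adj k = Σ (Subset V) λ S → IsLocalAdjBasis Adj S × ∣ S ∣ ≡ k

-- Corona product G ⊙ H.  Vertex set Fin (n + n * m), n = order G, m = order H:
-- splitAt n gives inj₁ i  (vertex v_i of G) or inj₂ k with remQuot m k = (i , a),
-- meaning vertex a of the copy H_i.
data CVert (n m : ℕ) : Set where
  gv : Fin n → CVert n m
  hv : Fin n → Fin m → CVert n m

cview : ∀ n m → Fin (n + n * m) → CVert n m
cview n m x with splitAt n x
... | inj₁ i = gv i
... | inj₂ k with remQuot m k
...   | (i , a) = hv i a

CAdj : (G H : Graph) → CVert (order G) (order H) → CVert (order G) (order H) → Set
CAdj G H (gv i)   (gv j)   = Adj G i j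
CAdj G H (gv i)   (hv j b) = i ≡ j
CAdj G H (hv i a) (gv j)   = i ≡ j
CAdj G H (hv i a) (hv j b) = (i ≡ j) × Adj H a b

CoronaOrder : Graph → Graph → ℕ
CoronaOrder G H = order G + order G * order H

CoronaAdj : (G H : Graph) → Fin (CoronaOrder G H) → Fin (CoronaOrder G H) → Set
CoronaAdj G H x y = CAdj G H (cview (order G) (order H) x) (cview (order G) (order H) y)

-- Every local adjacency generator of G ⊙ H restricts to one of each copy H_i, since a vertex of G
-- is adjacent to all of H_i; so it has at least n·|S| elements. Conversely the union of the n copies
-- of S is a generator: the non-domination condition on S is exactly what separates v_i from the
-- vertices of H_i outside S.
module Submission where

open import Defs
open import Data.Nat using (ℕ; _*_; _≤_)
open import Data.Fin using (Fin)
open import Data.Fin.Subset using (Subset; _∈_; _∉_; ∣_∣)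
open import Relation.Nullary using (¬_)
open import Relation.Binary.PropositionalEquality using (_≡_)

open import Data.Nat using (zero; suc; _+_; z≤n; s≤s)
open import Data.Nat.Properties using (≤-antisym; ≤-trans; _≤?_; +-mono-≤; m≤n+m; module ≤-Reasoning)
open import Data.Fin using (zero; suc; _↑ˡ_; _↑ʳ_; combine; fromℕ<)
open import Data.Fin.Properties using (splitAt-↑ˡ; splitAt-↑ʳ; remQuot-combine; combine-remQuot; join-splitAt; any?)
open import Data.Fin.Subset using (inside; outside) renaming (⊥ to ∅)
open import Data.Fin.Subset.Properties using (_∈?_; ∣⊥∣≡0)
open import Data.Vec using (Vec; []; _∷_; _++_; concat; lookup; map; replicate; sum; splitAt; group)
open import Data.Vec.Properties using ([]=⇒lookup; lookup⇒[]=; lookup-++ˡ; lookup-++ʳ; lookup-concat; lookup-replicate; map-replicate)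
open import Data.Product using (∃-syntax; ∃₂; _×_; _,_; proj₂; uncurry)
open import Data.Sum using (_⊎_; inj₁; inj₂)
open import Data.Empty using (⊥-elim)
open import Function using (_∘_)
open import Relation.Nullary using (Dec; yes; no; ¬?; _×-dec_)
open import Relation.Nullary.Decidable using (decidable-stable; ¬¬-excluded-middle)
open import Relation.Nullary.Negation using (¬¬-map)
open import Relation.Binary.PropositionalEquality using (refl; trans; cong; cong₂; subst; subst₂; module ≡-Reasoning) renaming (sym to ≡-sym)

¬¬-Π-Fin : ∀ {n} {P : Fin n → Set} → (∀ x → ¬ ¬ P x) → ¬ ¬ (∀ x → P x)
¬¬-Π-Fin {zero}  _ ¬∀ = ¬∀ λ ()
¬¬-Π-Fin {suc n} h ¬∀ = h zero λ p₀ → ¬¬-Π-Fin (h ∘ suc) λ pₛ →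
  ¬∀ λ { zero → p₀ ; (suc x) → pₛ x }

¬¬-decidable : ∀ {a b} (R : Fin a → Fin b → Set) → ¬ ¬ (∀ x y → Dec (R x y))
¬¬-decidable R = ¬¬-Π-Fin λ x → ¬¬-Π-Fin λ y → ¬¬-excluded-middle

∣p++q∣≡∣p∣+∣q∣ : ∀ {a b} (p : Subset a) (q : Subset b) → ∣ p ++ q ∣ ≡ ∣ p ∣ + ∣ q ∣
∣p++q∣≡∣p∣+∣q∣ []            q = refl
∣p++q∣≡∣p∣+∣q∣ (outside ∷ p) q = ∣p++q∣≡∣p∣+∣q∣ p q
∣p++q∣≡∣p∣+∣q∣ (inside  ∷ p) q = cong suc (∣p++q∣≡∣p∣+∣q∣ p q)

∣concat∣≡sum : ∀ {n m} (ps : Vec (Subset m) n) → ∣ concat ps ∣ ≡ sum (map ∣_∣ ps)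
∣concat∣≡sum []       = refl
∣concat∣≡sum (p ∷ ps) = trans (∣p++q∣≡∣p∣+∣q∣ p (concat ps)) (cong (∣ p ∣ +_) (∣concat∣≡sum ps))

*≤sum-map : ∀ {A : Set} {n} c (f : A → ℕ) (xs : Vec A n) →
  (∀ i → c ≤ f (lookup xs i)) → n * c ≤ sum (map f xs)
*≤sum-map c f []       _ = z≤n
*≤sum-map c f (x ∷ xs) h = +-mono-≤ (h zero) (*≤sum-map c f xs (h ∘ suc))

sum-replicate : ∀ n c → sum (replicate n c) ≡ n * c
sum-replicate zero    c = refl
sum-replicate (suc n) c = cong (c +_) (sum-replicate n c)

∈-transport : ∀ {a b} {p : Subset a} {q : Subset b} {x y} →
  lookup p x ≡ lookup q y → x ∈ p → y ∈ q
∈-transport {q = q} {y = y} eq x∈p = lookup⇒[]= y q (trans (≡-sym eq) ([]=⇒lookup x∈p))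

Undominated : ∀ {V} → (Fin V → Fin V → Set) → Subset V → Set
Undominated Adj S = ∀ v → v ∉ S → ∃[ s ] s ∈ S × ¬ Adj v s

undominated : ∀ {V} {Adj : Fin V → Fin V → Set} {S : Subset V} → (∀ x y → Dec (Adj x y)) →
  (∀ v → v ∉ S → ¬ (∀ s → s ∈ S → Adj v s)) → Undominated Adj S
undominated {S = S} adj? notDominated v v∉S with any? (λ s → s ∈? S ×-dec ¬? (adj? v s))
... | yes witness = witness
... | no none = ⊥-elim (notDominated v v∉S λ s s∈S →
  decidable-stable (adj? v s) (λ ¬adj → none (s , s∈S , ¬adj)))

undominated-nonempty : ∀ {V} {Adj : Fin V → Fin V → Set} {S : Subset V} →
  Undominated Adj S → Fin V → ∃[ s ] s ∈ S
undominated-nonempty {S = S} und v with v ∈? S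
... | yes v∈S = v , v∈S
... | no  v∉S = let s , s∈S , _ = und v v∉S in s , s∈S

-- Vertex sets of the corona are split as A ++ concat B: A ⊆ V(G), and B i ⊆ V(H_i).
module _ {n m : ℕ} where

  encode : CVert n m → Fin (n + n * m)
  encode (gv i)   = i ↑ˡ (n * m)
  encode (hv i a) = n ↑ʳ combine i a

  cview-encode : ∀ c → cview n m (encode c) ≡ c
  cview-encode (gv i)   rewrite splitAt-↑ˡ n i (n * m) = refl
  cview-encode (hv i a) rewrite splitAt-↑ʳ n (n * m) (combine i a) =
    cong (uncurry hv) (remQuot-combine {n} {m} i a)

  encode-cview : ∀ x → encode (cview n m x) ≡ x
  encode-cview x with Data.Fin.splitAt n x in eq
  ... | inj₁ i = trans (≡-sym (cong (Data.Fin.join n (n * m)) eq)) (join-splitAt n (n * m) x)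
  ... | inj₂ k = trans (cong (n ↑ʳ_) (combine-remQuot {n} m k))
                       (trans (≡-sym (cong (Data.Fin.join n (n * m)) eq)) (join-splitAt n (n * m) x))

  decompose : (W : Subset (n + n * m)) → ∃₂ λ A B → W ≡ A ++ concat B
  decompose W with splitAt n W
  ... | A , rest , refl with group n m rest
  ...   | B , refl = A , B , refl

  ∣A++concatB∣ : (A : Subset n) (B : Vec (Subset m) n) → ∣ A ++ concat B ∣ ≡ ∣ A ∣ + sum (map ∣_∣ B)
  ∣A++concatB∣ A B = trans (∣p++q∣≡∣p∣+∣q∣ A (concat B)) (cong (∣ A ∣ +_) (∣concat∣≡sum B))

  _∈⟨_,_⟩ : CVert n m → Subset n → Vec (Subset m) n → Set
  gv i   ∈⟨ A , B ⟩ = i ∈ A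
  hv i a ∈⟨ A , B ⟩ = a ∈ lookup B i

  ∈-encode⁺ : ∀ {A B} c → c ∈⟨ A , B ⟩ → encode c ∈ A ++ concat B
  ∈-encode⁺ {A} {B} (gv i)   = ∈-transport (≡-sym (lookup-++ˡ A (concat B) i))
  ∈-encode⁺ {A} {B} (hv i a) = ∈-transport (≡-sym (trans (lookup-++ʳ A (concat B) (combine i a)) (lookup-concat B i a)))

  ∈-encode⁻ : ∀ {A B} c → encode c ∈ A ++ concat B → c ∈⟨ A , B ⟩
  ∈-encode⁻ {A} {B} (gv i)   = ∈-transport (lookup-++ˡ A (concat B) i)
  ∈-encode⁻ {A} {B} (hv i a) = ∈-transport (trans (lookup-++ʳ A (concat B) (combine i a)) (lookup-concat B i a))

  ∈-cview⁺ : ∀ {A B} x → cview n m x ∈⟨ A , B ⟩ → x ∈ A ++ concat B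
  ∈-cview⁺ {A} {B} x = subst (_∈ A ++ concat B) (encode-cview x) ∘ ∈-encode⁺ (cview n m x)

  ∈-cview⁻ : ∀ {A B} x → x ∈ A ++ concat B → cview n m x ∈⟨ A , B ⟩
  ∈-cview⁻ {A} {B} x = ∈-encode⁻ (cview n m x) ∘ subst (_∈ A ++ concat B) (≡-sym (encode-cview x))

module _ (G H : Graph) where

  private
    n = order G
    m = order H

  CDistinguishes : (e c d : CVert n m) → Set
  CDistinguishes e c d = (CAdj G H e c × ¬ CAdj G H e d) ⊎ (¬ CAdj G H e c × CAdj G H e d)

  IsCoronaGen : Subset n → Vec (Subset m) n → Set
  IsCoronaGen A B = ∀ c d → CAdj G H c d → ¬ c ∈⟨ A , B ⟩ → ¬ d ∈⟨ A , B ⟩ →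
    ∃[ e ] e ∈⟨ A , B ⟩ × CDistinguishes e c d

  gen⇒coronaGen : ∀ {A B} → IsLocalAdjGen (CoronaAdj G H) (A ++ concat B) → IsCoronaGen A B
  gen⇒coronaGen gen c d cd c∉ d∉
    with gen (encode c) (encode d) (subst₂ (CAdj G H) (≡-sym (cview-encode c)) (≡-sym (cview-encode d)) cd)
             (c∉ ∘ ∈-encode⁻ c) (d∉ ∘ ∈-encode⁻ d)
  ... | s , s∈W , sep = cview n m s , ∈-cview⁻ s s∈W
                      , subst₂ (CDistinguishes (cview n m s)) (cview-encode c) (cview-encode d) sep

  coronaGen⇒gen : ∀ {A B} → IsCoronaGen A B → IsLocalAdjGen (CoronaAdj G H) (A ++ concat B)
  coronaGen⇒gen gen x y xy x∉ y∉ with gen (cview n m x) (cview n m y) xy (x∉ ∘ ∈-cview⁺ x) (y∉ ∘ ∈-cview⁺ y)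
  ... | e , e∈ , sep = encode e , ∈-encode⁺ e e∈
                     , subst (λ c → CDistinguishes c (cview n m x) (cview n m y)) (≡-sym (cview-encode e)) sep

  coronaGen⇒copyGen : ∀ {A B} → IsCoronaGen A B → ∀ i → IsLocalAdjGen (Adj H) (lookup B i)
  coronaGen⇒copyGen gen i a b ab a∉ b∉ with gen (hv i a) (hv i b) (refl , ab) a∉ b∉
  ... | gv _   , _ , inj₁ (ja , ¬jb)               = ⊥-elim (¬jb ja)
  ... | gv _   , _ , inj₂ (¬ja , jb)               = ⊥-elim (¬ja jb)
  ... | hv _ s , s∈ , inj₁ ((refl , sa) , ¬sb)     = s , s∈ , inj₁ (sa , λ sb → ¬sb (refl , sb))
  ... | hv _ s , s∈ , inj₂ (¬sa , (refl , sb))     = s , s∈ , inj₂ ((λ sa → ¬sa (refl , sa)) , sb)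

  -- Two vertices v_i, v_j of G are separated by any vertex of B i, which is nonempty.
  copiesGen : ∀ {A B} → Fin m →
    (∀ i → IsLocalAdjGen (Adj H) (lookup B i)) → (∀ i → Undominated (Adj H) (lookup B i)) →
    IsCoronaGen A B
  copiesGen v gen und (gv i) (gv j) ij _ _ =
    let s , s∈ = undominated-nonempty (und i) v in hv i s , s∈ , inj₁ (refl , λ { refl → irrefl G ij })
  copiesGen v gen und (gv i) (hv .i b) refl _ b∉ =
    let s , s∈ , ¬bs = und i b b∉ in hv i s , s∈ , inj₁ (refl , ¬bs ∘ Graph.sym H ∘ proj₂)
  copiesGen v gen und (hv i a) (gv .i) refl a∉ _ =
    let s , s∈ , ¬as = und i a a∉ in hv i s , s∈ , inj₂ (¬as ∘ Graph.sym H ∘ proj₂ , refl)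
  copiesGen v gen und (hv i a) (hv .i b) (refl , ab) a∉ b∉ with gen i a b ab a∉ b∉
  ... | s , s∈ , inj₁ (sa , ¬sb) = hv i s , s∈ , inj₁ ((refl , sa) , ¬sb ∘ proj₂)
  ... | s , s∈ , inj₂ (¬sa , sb) = hv i s , s∈ , inj₂ (¬sa ∘ proj₂ , (refl , sb))

  basis-size≤gen-size : ∀ {S W} → IsLocalAdjBasis (Adj H) S → IsLocalAdjGen (CoronaAdj G H) W →
    n * ∣ S ∣ ≤ ∣ W ∣
  basis-size≤gen-size {S} {W} (_ , minimal) gen with decompose {n} {m} W
  ... | A , B , refl = begin
    n * ∣ S ∣               ≤⟨ *≤sum-map ∣ S ∣ ∣_∣ B (λ i → minimal _ (coronaGen⇒copyGen (gen⇒coronaGen {A} {B} gen) i)) ⟩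
    sum (map ∣_∣ B)         ≤⟨ m≤n+m _ ∣ A ∣ ⟩
    ∣ A ∣ + sum (map ∣_∣ B) ≡⟨ ≡-sym (∣A++concatB∣ A B) ⟩
    ∣ A ++ concat B ∣       ∎
    where open ≤-Reasoning

  ∣copies∣ : (S : Subset m) → ∣ ∅ {n} ++ concat (replicate n S) ∣ ≡ n * ∣ S ∣
  ∣copies∣ S = begin
    ∣ ∅ {n} ++ concat (replicate n S) ∣          ≡⟨ ∣A++concatB∣ ∅ (replicate n S) ⟩
    ∣ ∅ {n} ∣ + sum (map ∣_∣ (replicate n S))    ≡⟨ cong₂ _+_ (∣⊥∣≡0 n) (cong sum (map-replicate ∣_∣ S n)) ⟩
    sum (replicate n ∣ S ∣)                      ≡⟨ sum-replicate n ∣ S ∣ ⟩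
    n * ∣ S ∣                                    ∎
    where open ≡-Reasoning

-- Adjacency in H is decidable only up to double negation, which suffices as the goal k ≤ n|S| is decidable.
theorem20 : (G H : Graph) → Connected G → 2 ≤ order G → NonTrivial H →
    (S : Subset (order H)) → IsLocalAdjBasis (Adj H) S →
    (∀ (v : Fin (order H)) → v ∉ S → ¬ (∀ (s : Fin (order H)) → s ∈ S → Adj H v s)) →
    (k : ℕ) → LocalAdjDim (CoronaAdj G H) k → k ≡ order G * ∣ S ∣
theorem20 G H _ _ nonTrivial S basis@(genS , _) notDominated _ (W , (genW , minimalW) , refl) =
  ≤-antisym (decidable-stable (_ ≤? _) (¬¬-map upper (¬¬-decidable (Adj H))))
            (basis-size≤gen-size G H basis genW)
  where
  v : Fin (order H)
  v = fromℕ< (≤-trans (s≤s z≤n) nonTrivial)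

  copy : (P : Subset (order H) → Set) → P S → ∀ i → P (lookup (replicate (order G) S) i)
  copy P p i = subst P (≡-sym (lookup-replicate i S)) p

  upper : (∀ x y → Dec (Adj H x y)) → ∣ W ∣ ≤ order G * ∣ S ∣
  upper adj? = subst (∣ W ∣ ≤_) (∣copies∣ G H S)
    (minimalW _ (coronaGen⇒gen G H {∅} {replicate (order G) S} (copiesGen G H v
      (copy (IsLocalAdjGen (Adj H)) genS) (copy (Undominated (Adj H)) (undominated adj? notDominated)))))
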